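{- Let $I$ and $K$ be compositions of $n$ with $K\ge I$, i.e. $\mathrm{Des}(I)\subseteq\mathrm{Des}(K)$. Then $$\sum_{J\in[I,K]}M_J\Big(\frac1{1-q}\Big)=\frac{1}{1-q^n}\cdot\frac{q^{\mathrm{maj}(I)}}{\prod_{d\in\mathrm{Des}(K)}(1-q^d)},$$ where $[I,K]$ is the set of compositions $J$ of $n$ with $\mathrm{Des}(I)\subseteq\mathrm{Des}(J)\subseteq\mathrm{Des}(K)$.
   Context: For a composition $I=(i_1,\dots,i_r)$ of $n$, $\mathrm{Des}(I)=\{i_1,i_1+i_2,\dots,i_1+\cdots+i_{r-1}\}$ and $\mathrm{maj}(I)=\sum_{d\in\mathrm{Des}(I)}d$. $M_J$ is the monomial quasi-symmetric function, and $M_J(\frac1{1-q})$ denotes its evaluation at the alphabet $x_1=1,x_2=q,x_3=q^2,\dots$. -}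

module Defs where

open import Data.Nat using (ℕ; zero; suc; _+_; _*_; _∸_; _≤_; _<_; _≟_)
open import Data.Nat.Divisibility using (_∣?_)
open import Data.Bool using (if_then_else_)
open import Data.Nat.ListAction using (sum)
open import Data.List using (List; []; _∷_; map; filter; length; foldr; concatMap; upTo; allFin)
open import Data.List.Relation.Unary.All using (All; all?)
open import Data.List.Membership.Propositional using (_∈_)
open import Data.List.Membership.DecPropositional _≟_ using (_∈?_)
open import Data.Product using (_×_)
open import Relation.Nullary using (Dec; yes; no; ¬_)
open import Relation.Nullary.Decidable using (⌊_⌋; _×-dec_)
open import Relation.Binary.PropositionalEquality using (_≡_)

IsComposition : ℕ → List ℕ → Set
IsComposition n I = All (λ i → 1 ≤ i) I × sum I ≡ n

desFrom : ℕ → List ℕ → List ℕ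
desFrom acc []           = []
desFrom acc (i ∷ [])     = []
desFrom acc (i ∷ j ∷ js) = (acc + i) ∷ desFrom (acc + i) (j ∷ js)

des : List ℕ → List ℕ
des I = desFrom 0 I

maj : List ℕ → ℕ
maj I = sum (des I)

-- Enumeration of all compositions of n (each exactly once):
-- a composition of n+2 arises from a composition J of n+1 either by
-- prepending a part 1, or by adding 1 to the first part of J.
bumpHead : List ℕ → List ℕ
bumpHead []       = []
bumpHead (j ∷ js) = suc j ∷ js

comps : ℕ → List (List ℕ)
comps zero          = [] ∷ []
comps (suc zero)    = (1 ∷ []) ∷ []
comps (suc (suc n)) = concatMap (λ J → (1 ∷ J) ∷ bumpHead J ∷ []) (comps (suc n))

inInterval? : (I K J : List ℕ) →
  Dec (All (λ d → d ∈ des J) (des I) × All (λ d → d ∈ des K) (des J))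
inInterval? I K J = all? (λ d → d ∈? des J) (des I) ×-dec all? (λ d → d ∈? des K) (des J)

interval : ℕ → List ℕ → List ℕ → List (List ℕ)
interval n I K = filter (inInterval? I K) (comps n)

-- Formal power series in q with coefficients in ℕ
-- (all series occurring here have nonnegative coefficients);
-- a series is its coefficient sequence, equality is coefficientwise.

Series : Set
Series = ℕ → ℕ

sumTo : ℕ → (ℕ → ℕ) → ℕ
sumTo zero    f = f 0
sumTo (suc m) f = sumTo m f + f (suc m)

_⊛_ : Series → Series → Series
(f ⊛ g) m = sumTo m (λ i → f i * g (m ∸ i))

infixl 7 _⊛_

zeroS : Series
zeroS _ = 0

_⊕_ : Series → Series → Series
(f ⊕ g) m = f m + g m

sumS : List Series → Series
sumS = foldr _⊕_ zeroS

qpow : ℕ → Series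
qpow k m = if ⌊ m ≟ k ⌋ then 1 else 0

oneS : Series
oneS = qpow 0

-- 1/(1 - q^d) = Σ_{t ≥ 0} q^{t d}   (for d ≥ 1: coefficient of q^m is 1 iff d ∣ m)
inv1mq : ℕ → Series
inv1mq d m = if ⌊ d ∣? m ⌋ then 1 else 0

prodInv : List ℕ → Series
prodInv D = foldr (λ d s → inv1mq d ⊛ s) oneS D

-- M_J(1/(1-q)) : evaluation of the monomial quasi-symmetric function
-- at the alphabet x_a = q^{a-1} (a ≥ 1), with the convention
--   M_J = Σ_{a₁ > ⋯ > a_r} x_{a₁}^{j₁} ⋯ x_{a_r}^{j_r}
-- (with the opposite order a₁ < ⋯ < a_r the
-- stated identity is false, e.g. I=(1,3), K=(1,1,2)).
-- Writing b_k = a_k - 1 ≥ 0, the coefficient of q^m is the number of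
-- sequences b₁ > ⋯ > b_r of naturals with Σ b_k j_k = m. Since all parts
-- j_k ≥ 1, every such b_k ≤ m, so it suffices to range over tuples with
-- entries in {0,…,m}.

tuples : ℕ → ℕ → List (List ℕ)
tuples m zero    = [] ∷ []
tuples m (suc r) = concatMap (λ b → map (b ∷_) (tuples m r)) (upTo (suc m))

data StrictlyDecreasing : List ℕ → Set where
  sd[]  : StrictlyDecreasing []
  sd[-] : ∀ {b} → StrictlyDecreasing (b ∷ [])
  sd∷ : ∀ {b c bs} → c < b → StrictlyDecreasing (c ∷ bs) → StrictlyDecreasing (b ∷ c ∷ bs)

strictlyDecreasing? : (bs : List ℕ) → Dec (StrictlyDecreasing bs)
strictlyDecreasing? [] = yes sd[]
strictlyDecreasing? (b ∷ []) = yes sd[-]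
strictlyDecreasing? (b ∷ c ∷ bs) with Data.Nat._<?_ c b | strictlyDecreasing? (c ∷ bs)
... | yes p | yes q = yes (sd∷ p q)
... | no ¬p | _     = no λ { (sd∷ p _) → ¬p p }
... | yes _ | no ¬q = no λ { (sd∷ _ q) → ¬q q }

weight : List ℕ → List ℕ → ℕ
weight [] _ = 0
weight (b ∷ bs) [] = 0
weight (b ∷ bs) (j ∷ js) = b * j + weight bs js

evalM : List ℕ → Series
evalM J m = length (filter (λ bs → strictlyDecreasing? bs ×-dec (weight bs J ≟ m))
                           (tuples m (length J)))

-- Write M_J(1/(1-q)) = Σ q^{Σ b_k j_k} over b₁ > ⋯ > b_r ≥ 0. Lowering b₁ by one either keeps the
-- sequence strictly decreasing or makes b₁ = b₂, which merges the first two parts; hence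
-- M_{(j₁,j₂,…)} = q^{j₁}(M_{(j₁,j₂,…)} + M_{(j₁+j₂,…)}) and M_{(j)} = 1 + q^j M_{(j)}. Such equations
-- X = Z + q^j X (j ≥ 1) have unique solutions, and induction on the number of parts gives
-- M_J(1/(1-q)) = (1/(1-q^n)) Π_{d ∈ Des J} q^d/(1-q^d).
-- Encoding a composition of n by the indicator vector of its descent set in {1,…,n-1}, the
-- interval [I,K] becomes a box of Boolean vectors and the sum factorises over coordinates: a
-- descent d of I contributes q^d/(1-q^d), one of K but not of I contributes 1 + q^d/(1-q^d) = 1/(1-q^d),
-- and a non-descent of K contributes 1, which multiplies out to q^{maj I} / Π_{d ∈ Des K} (1-q^d).

module Submission where

open import Defs
open import Algebra.Bundles using (CommutativeSemigroup)
import Algebra.Properties.CommutativeSemigroup as CommutativeSemigroupProperties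
open import Data.Bool using (Bool; true; false; b≤b; f≤t)
import Data.Bool as Bool
open import Data.Bool.Properties using () renaming (_≤?_ to _≤ᵇ?_)
open import Data.List using (List; []; _∷_; map; _++_; applyUpTo; upTo; length; filter; concatMap; foldr)
open import Data.List.Membership.Propositional using (_∈_)
open import Data.List.Membership.Propositional.Properties using (∈-map⁺; ∈-map⁻)
open import Data.List.Properties
  using (applyUpTo-∷ʳ; map-applyUpTo; map-∘; map-++; length-++; length-map; concatMap-map; map-concatMap; foldr-map;
         filter-++; filter-≐; filter-none; filter-accept; filter-reject)
open import Data.List.Relation.Binary.Subset.Propositional using (_⊆_)
open import Data.List.Relation.Binary.Subset.Propositional.Properties using (map⁺; ∷⁺ʳ; xs⊆x∷xs; ⊆-trans)
open import Data.List.Relation.Unary.All as All using (All; []; _∷_)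
open import Data.List.Relation.Unary.Any using (here; there)
open import Data.Nat using (ℕ; zero; suc; _+_; _*_; _∸_; _≤_; _<_; z≤n; s≤s; z<s; s<s; _≟_; _≤?_; >-nonZero)
open import Data.Nat.Divisibility using (_∣_; _∣?_; _∣0; ∣m+n∣m⇒∣n; ∣m∸n∣n⇒∣m; ∣-refl; ∣⇒≤)
open import Data.Nat.Induction using (<-rec)
open import Data.Nat.ListAction using (sum)
open import Data.Nat.ListAction.Properties using (sum-++)
open import Data.Nat.Properties
open import Data.Product using (Σ; _×_; _,_)
open import Data.Vec using (Vec; []; _∷_)
open import Data.Vec.Relation.Binary.Pointwise.Inductive as Pointwise using (Pointwise; []; _∷_)
open import Function using (_∘_; const; id)
open import Level using (0ℓ)
open import Relation.Binary.Bundles using (Setoid)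
open import Relation.Binary.PropositionalEquality
import Relation.Binary.Reasoning.Setoid as SetoidReasoning
open import Relation.Nullary using (yes; no; ¬_; does)
open import Relation.Nullary.Decidable using (_×-dec_)
open import Relation.Nullary.Negation using (contradiction)
open import Relation.Unary using (Pred; Decidable)

open CommutativeSemigroupProperties +-commutativeSemigroup using (interchange)
open CommutativeSemigroupProperties *-commutativeSemigroup using () renaming (x∙yz≈y∙xz to x*yz≡y*xz)

series-setoid : Setoid _ _
series-setoid = ℕ →-setoid ℕ

module ≗ = Setoid series-setoid

sumTo-cong : ∀ m {f g : ℕ → ℕ} → (∀ i → i ≤ m → f i ≡ g i) → sumTo m f ≡ sumTo m g
sumTo-cong zero    f≗g = f≗g 0 z≤n
sumTo-cong (suc m) f≗g =
  cong₂ _+_ (sumTo-cong m (λ i i≤m → f≗g i (m≤n⇒m≤1+n i≤m))) (f≗g (suc m) ≤-refl)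

sumTo-suc : ∀ m (f : ℕ → ℕ) → sumTo (suc m) f ≡ f 0 + sumTo m (f ∘ suc)
sumTo-suc zero    f = refl
sumTo-suc (suc m) f = trans (cong (_+ f (2 + m)) (sumTo-suc m f)) (+-assoc (f 0) _ _)

sumTo-+ : ∀ m (f g : ℕ → ℕ) → sumTo m (λ i → f i + g i) ≡ sumTo m f + sumTo m g
sumTo-+ zero    f g = refl
sumTo-+ (suc m) f g =
  trans (cong (_+ (f (suc m) + g (suc m))) (sumTo-+ m f g))
        (interchange (sumTo m f) (sumTo m g) (f (suc m)) (g (suc m)))

*-distribˡ-sumTo : ∀ x m (f : ℕ → ℕ) → x * sumTo m f ≡ sumTo m (λ i → x * f i)
*-distribˡ-sumTo x zero    f = refl
*-distribˡ-sumTo x (suc m) f =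
  trans (*-distribˡ-+ x (sumTo m f) (f (suc m))) (cong (_+ x * f (suc m)) (*-distribˡ-sumTo x m f))

sumTo-0 : ∀ m → sumTo m (const 0) ≡ 0
sumTo-0 zero    = refl
sumTo-0 (suc m) = trans (+-identityʳ _) (sumTo-0 m)

sumTo-reverse : ∀ m (f : ℕ → ℕ) → sumTo m f ≡ sumTo m (λ i → f (m ∸ i))
sumTo-reverse zero    f = refl
sumTo-reverse (suc m) f = begin
  sumTo m f + f (suc m)                 ≡⟨ cong (_+ f (suc m)) (sumTo-reverse m f) ⟩
  sumTo m (λ i → f (m ∸ i)) + f (suc m) ≡⟨ +-comm _ (f (suc m)) ⟩
  f (suc m) + sumTo m (λ i → f (m ∸ i)) ≡⟨ sym (sumTo-suc m (λ i → f (suc m ∸ i))) ⟩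
  sumTo (suc m) (λ i → f (suc m ∸ i))   ∎
  where open ≡-Reasoning

sumTo-antidiagonal : ∀ m (F : ℕ → ℕ → ℕ) → sumTo m (λ i → F i (m ∸ i)) ≡ sumTo m (λ i → F (m ∸ i) i)
sumTo-antidiagonal m F =
  trans (sumTo-reverse m _) (sumTo-cong m (λ i i≤m → cong (F (m ∸ i)) (m∸[m∸n]≡n i≤m)))

triangleSum : ℕ → (ℕ → ℕ → ℕ) → ℕ
triangleSum m F = sumTo m (λ i → sumTo (m ∸ i) (F i))

triangleSum-suc : ∀ m F → triangleSum (suc m) F ≡ triangleSum m F + sumTo (suc m) (λ i → F i (suc m ∸ i))
triangleSum-suc m F = begin
  sumTo m (λ i → sumTo (suc m ∸ i) (F i)) + sumTo (m ∸ m) (F (suc m))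
    ≡⟨ cong₂ _+_ (sumTo-cong m (λ i i≤m → row i i≤m)) corner ⟩
  sumTo m (λ i → sumTo (m ∸ i) (F i) + F i (suc m ∸ i)) + F (suc m) (m ∸ m)
    ≡⟨ cong (_+ F (suc m) (m ∸ m)) (sumTo-+ m _ _) ⟩
  triangleSum m F + sumTo m (λ i → F i (suc m ∸ i)) + F (suc m) (m ∸ m)
    ≡⟨ +-assoc (triangleSum m F) _ _ ⟩
  triangleSum m F + sumTo (suc m) (λ i → F i (suc m ∸ i)) ∎
  where
    open ≡-Reasoning
    row : ∀ i → i ≤ m → sumTo (suc m ∸ i) (F i) ≡ sumTo (m ∸ i) (F i) + F i (suc m ∸ i)
    row i i≤m rewrite +-∸-assoc 1 i≤m = refl
    corner : sumTo (m ∸ m) (F (suc m)) ≡ F (suc m) (m ∸ m)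
    corner rewrite n∸n≡0 m = refl

triangleSum-transpose : ∀ m F → triangleSum m F ≡ triangleSum m (λ i j → F j i)
triangleSum-transpose zero    F = refl
triangleSum-transpose (suc m) F = begin
  triangleSum (suc m) F
    ≡⟨ triangleSum-suc m F ⟩
  triangleSum m F + sumTo (suc m) (λ i → F i (suc m ∸ i))
    ≡⟨ cong₂ _+_ (triangleSum-transpose m F) (sumTo-antidiagonal (suc m) F) ⟩
  triangleSum m F′ + sumTo (suc m) (λ i → F′ i (suc m ∸ i))
    ≡⟨ triangleSum-suc m F′ ⟨
  triangleSum (suc m) F′ ∎
  where
    open ≡-Reasoning
    F′ = λ i j → F j i

qpow-≡ : ∀ a → qpow a a ≡ 1
qpow-≡ a with a ≟ a
... | yes _   = refl
... | no a≢a = contradiction refl a≢a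

qpow-≢ : ∀ {a m} → m ≢ a → qpow a m ≡ 0
qpow-≢ {a} {m} m≢a with m ≟ a
... | yes m≡a = contradiction m≡a m≢a
... | no _    = refl

qpow-resp : ∀ {k m k′ m′} → (m ≡ k → m′ ≡ k′) → (m′ ≡ k′ → m ≡ k) → qpow k m ≡ qpow k′ m′
qpow-resp {k} {m} {k′} {m′} to from with m ≟ k | m′ ≟ k′
... | yes _   | yes _    = refl
... | no  _   | no  _    = refl
... | yes m≡k | no m′≢k′ = contradiction (to m≡k) m′≢k′
... | no m≢k  | yes m′≡k′ = contradiction (from m′≡k′) m≢k

sumTo-qpow-≰ : ∀ m a (g : ℕ → ℕ) → ¬ a ≤ m → sumTo m (λ i → qpow a i * g i) ≡ 0
sumTo-qpow-≰ zero    a g a≰m = cong (_* g 0) (qpow-≢ (λ 0≡a → a≰m (subst (_≤ 0) 0≡a z≤n)))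
sumTo-qpow-≰ (suc m) a g a≰m = cong₂ _+_
  (sumTo-qpow-≰ m a g (a≰m ∘ m≤n⇒m≤1+n))
  (cong (_* g (suc m)) (qpow-≢ (λ m+1≡a → a≰m (subst (_≤ suc m) m+1≡a ≤-refl))))

sumTo-qpow-≤ : ∀ m a (g : ℕ → ℕ) → a ≤ m → sumTo m (λ i → qpow a i * g i) ≡ g a
sumTo-qpow-≤ zero    .0 g z≤n = trans (cong (_* g 0) (qpow-≡ 0)) (+-identityʳ _)
sumTo-qpow-≤ (suc m) a  g a≤m with a ≟ suc m
... | yes refl = trans (cong₂ _+_ (sumTo-qpow-≰ m (suc m) g (<-irrefl refl))
                                  (cong (_* g (suc m)) (qpow-≡ (suc m))))
                       (+-identityʳ _)
... | no a≢m+1 = trans (cong₂ _+_ (sumTo-qpow-≤ m a g (≤-pred (≤∧≢⇒< a≤m a≢m+1)))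
                                  (cong (_* g (suc m)) (qpow-≢ (a≢m+1 ∘ sym))))
                       (+-identityʳ _)

shift : ℕ → Series → Series
shift a f s with a ≤? s
... | yes _ = f (s ∸ a)
... | no  _ = 0

shift-≤ : ∀ {a s} (f : Series) → a ≤ s → shift a f s ≡ f (s ∸ a)
shift-≤ {a} {s} f a≤s with a ≤? s
... | yes _   = refl
... | no a≰s = contradiction a≤s a≰s

shift-≰ : ∀ {a s} (f : Series) → ¬ a ≤ s → shift a f s ≡ 0
shift-≰ {a} {s} f a≰s with a ≤? s
... | yes a≤s = contradiction a≤s a≰s
... | no _    = refl

qpow-⊛ : ∀ a f → qpow a ⊛ f ≗ shift a f
qpow-⊛ a f m with a ≤? m
... | yes a≤m = sumTo-qpow-≤ m a (λ i → f (m ∸ i)) a≤m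
... | no a≰m  = sumTo-qpow-≰ m a (λ i → f (m ∸ i)) a≰m

⊛-cong : ∀ {f f′ g g′} → f ≗ f′ → g ≗ g′ → f ⊛ g ≗ f′ ⊛ g′
⊛-cong f≗f′ g≗g′ m = sumTo-cong m (λ i _ → cong₂ _*_ (f≗f′ i) (g≗g′ (m ∸ i)))

⊛-congˡ : ∀ h {f g} → f ≗ g → h ⊛ f ≗ h ⊛ g
⊛-congˡ h = ⊛-cong {h} (λ _ → refl)

⊛-congʳ : ∀ h {f g} → f ≗ g → f ⊛ h ≗ g ⊛ h
⊛-congʳ h f≗g = ⊛-cong {g = h} {g′ = h} f≗g (λ _ → refl)

⊕-cong : ∀ {f f′ g g′} → f ≗ f′ → g ≗ g′ → f ⊕ g ≗ f′ ⊕ g′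
⊕-cong f≗f′ g≗g′ m = cong₂ _+_ (f≗f′ m) (g≗g′ m)

⊕-comm : ∀ f g → f ⊕ g ≗ g ⊕ f
⊕-comm f g m = +-comm (f m) (g m)

⊛-comm : ∀ f g → f ⊛ g ≗ g ⊛ f
⊛-comm f g m = trans (sumTo-reverse m _) (sumTo-cong m (λ i i≤m →
  trans (cong (λ k → f (m ∸ i) * g k) (m∸[m∸n]≡n i≤m)) (*-comm (f (m ∸ i)) (g i))))

⊛-assoc : ∀ f g h → (f ⊛ g) ⊛ h ≗ f ⊛ (g ⊛ h)
⊛-assoc f g h m = begin
  ((f ⊛ g) ⊛ h) m                             ≡⟨ ⊛-comm (f ⊛ g) h m ⟩
  (h ⊛ (f ⊛ g)) m                             ≡⟨ sumTo-cong m (λ i _ → *-distribˡ-sumTo (h i) (m ∸ i) _) ⟩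
  triangleSum m (λ i j → h i * (f j * g (m ∸ i ∸ j)))
    ≡⟨ triangleSum-transpose m _ ⟩
  triangleSum m (λ i j → h j * (f i * g (m ∸ j ∸ i)))
    ≡⟨ sumTo-cong m (λ i _ → sumTo-cong (m ∸ i) (λ j _ →
         trans (x*yz≡y*xz (h j) (f i) _) (cong (λ k → f i * (h j * g k)) (∸-swap j i)))) ⟩
  triangleSum m (λ i j → f i * (h j * g (m ∸ i ∸ j)))
    ≡⟨ sumTo-cong m (λ i _ → sym (*-distribˡ-sumTo (f i) (m ∸ i) _)) ⟩
  (f ⊛ (h ⊛ g)) m                             ≡⟨ ⊛-congˡ f (⊛-comm h g) m ⟩
  (f ⊛ (g ⊛ h)) m                             ∎
  where
    open ≡-Reasoning
    ∸-swap : ∀ a b → m ∸ a ∸ b ≡ m ∸ b ∸ a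
    ∸-swap a b = trans (∸-+-assoc m a b) (trans (cong (m ∸_) (+-comm a b)) (sym (∸-+-assoc m b a)))

⊛-identityˡ : ∀ f → oneS ⊛ f ≗ f
⊛-identityˡ f m = trans (qpow-⊛ 0 f m) (shift-≤ f z≤n)

⊛-identityʳ : ∀ f → f ⊛ oneS ≗ f
⊛-identityʳ f = ≗.trans (⊛-comm f oneS) (⊛-identityˡ f)

⊛-zeroʳ : ∀ f → f ⊛ zeroS ≗ zeroS
⊛-zeroʳ f m = trans (sumTo-cong m (λ i _ → *-zeroʳ (f i))) (sumTo-0 m)

⊛-distribˡ-⊕ : ∀ h f g → h ⊛ (f ⊕ g) ≗ (h ⊛ f) ⊕ (h ⊛ g)
⊛-distribˡ-⊕ h f g m =
  trans (sumTo-cong m (λ i _ → *-distribˡ-+ (h i) (f (m ∸ i)) (g (m ∸ i)))) (sumTo-+ m _ _)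

⊛-distribʳ-⊕ : ∀ h f g → (f ⊕ g) ⊛ h ≗ (f ⊛ h) ⊕ (g ⊛ h)
⊛-distribʳ-⊕ h f g = ≗.trans (⊛-comm (f ⊕ g) h)
  (≗.trans (⊛-distribˡ-⊕ h f g) (⊕-cong (⊛-comm h f) (⊛-comm h g)))

⊛-commutativeSemigroup : CommutativeSemigroup 0ℓ 0ℓ
⊛-commutativeSemigroup = record
  { Carrier                = Series
  ; _≈_                    = _≗_
  ; _∙_                    = _⊛_
  ; isCommutativeSemigroup = record
    { isSemigroup = record
      { isMagma = record { isEquivalence = ≗.isEquivalence ; ∙-cong = ⊛-cong }
      ; assoc   = ⊛-assoc
      }
    ; comm = ⊛-comm
    }
  }

open CommutativeSemigroupProperties ⊛-commutativeSemigroup using ()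
  renaming (x∙yz≈y∙xz to x⊛yz≗y⊛xz; interchange to ⊛-interchange)

sumS-cong : ∀ {A : Set} {F G : A → Series} → (∀ x → F x ≗ G x) → ∀ xs → sumS (map F xs) ≗ sumS (map G xs)
sumS-cong F≗G []       = ≗.refl
sumS-cong F≗G (x ∷ xs) = ⊕-cong (F≗G x) (sumS-cong F≗G xs)

sumS-++ : ∀ fs gs → sumS (fs ++ gs) ≗ sumS fs ⊕ sumS gs
sumS-++ []       gs m = refl
sumS-++ (f ∷ fs) gs m = trans (cong (f m +_) (sumS-++ fs gs m)) (sym (+-assoc (f m) _ _))

sumS-concatMap : ∀ {A B : Set} (F : B → Series) (g : A → List B) xs →
  sumS (map F (concatMap g xs)) ≗ sumS (map (λ x → sumS (map F (g x))) xs)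
sumS-concatMap F g []       = ≗.refl
sumS-concatMap F g (x ∷ xs) = begin
  sumS (map F (g x ++ concatMap g xs))
    ≡⟨ cong sumS (map-++ F (g x) (concatMap g xs)) ⟩
  sumS (map F (g x) ++ map F (concatMap g xs))
    ≈⟨ sumS-++ (map F (g x)) _ ⟩
  sumS (map F (g x)) ⊕ sumS (map F (concatMap g xs))
    ≈⟨ ⊕-cong {sumS (map F (g x))} ≗.refl (sumS-concatMap F g xs) ⟩
  sumS (map (λ x → sumS (map F (g x))) (x ∷ xs)) ∎
  where open SetoidReasoning series-setoid

⊛-distribˡ-sumS : ∀ {A : Set} H (F : A → Series) xs → sumS (map (λ x → H ⊛ F x) xs) ≗ H ⊛ sumS (map F xs)
⊛-distribˡ-sumS H F []       = ≗.sym (⊛-zeroʳ H)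
⊛-distribˡ-sumS H F (x ∷ xs) =
  ≗.trans (⊕-cong {H ⊛ F x} ≗.refl (⊛-distribˡ-sumS H F xs)) (≗.sym (⊛-distribˡ-⊕ H (F x) (sumS (map F xs))))

⊛-distribʳ-sumS : ∀ {A : Set} H (F : A → Series) xs → sumS (map (λ x → F x ⊛ H) xs) ≗ sumS (map F xs) ⊛ H
⊛-distribʳ-sumS H F xs = ≗.trans (sumS-cong (λ x → ⊛-comm (F x) H) xs)
  (≗.trans (⊛-distribˡ-sumS H F xs) (⊛-comm H (sumS (map F xs))))

filter-map : ∀ {A B : Set} {P : Pred B 0ℓ} (P? : Decidable P) (f : A → B) xs →
             filter P? (map f xs) ≡ map f (filter (P? ∘ f) xs)
filter-map P? f []       = refl
filter-map P? f (x ∷ xs) with does (P? (f x))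
... | true  = cong (f x ∷_) (filter-map P? f xs)
... | false = filter-map P? f xs

length-filter-concatMap : ∀ {A B : Set} {P : Pred B 0ℓ} (P? : Decidable P) (g : A → List B) xs →
  length (filter P? (concatMap g xs)) ≡ sum (map (λ x → length (filter P? (g x))) xs)
length-filter-concatMap P? g []       = refl
length-filter-concatMap P? g (x ∷ xs) = begin
  length (filter P? (g x ++ concatMap g xs))                  ≡⟨ cong length (filter-++ P? (g x) _) ⟩
  length (filter P? (g x) ++ filter P? (concatMap g xs))      ≡⟨ length-++ (filter P? (g x)) ⟩
  length (filter P? (g x)) + length (filter P? (concatMap g xs))
    ≡⟨ cong (length (filter P? (g x)) +_) (length-filter-concatMap P? g xs) ⟩
  sum (map (λ x → length (filter P? (g x))) (x ∷ xs))        ∎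
  where open ≡-Reasoning

-- Σ_{b<n} f b, opaque so that unification sees the summand f rather than an unfolded sum
opaque
  ∑< : ℕ → (ℕ → ℕ) → ℕ
  ∑< n f = sum (applyUpTo f n)

opaque
  unfolding ∑<

  ∑<-zero : ∀ (f : ℕ → ℕ) → ∑< 0 f ≡ 0
  ∑<-zero f = refl

  ∑<-sucˡ : ∀ n (f : ℕ → ℕ) → ∑< (suc n) f ≡ f 0 + ∑< n (f ∘ suc)
  ∑<-sucˡ n f = refl

  sum-map-upTo : ∀ n (f : ℕ → ℕ) → sum (map f (upTo n)) ≡ ∑< n f
  sum-map-upTo n f = cong sum (map-applyUpTo id f n)

  ∑<-cong : ∀ n {f g : ℕ → ℕ} → (∀ i → i < n → f i ≡ g i) → ∑< n f ≡ ∑< n g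
  ∑<-cong zero    f≗g = refl
  ∑<-cong (suc n) f≗g = cong₂ _+_ (f≗g 0 z<s) (∑<-cong n (λ i i<n → f≗g (suc i) (s<s i<n)))

  ∑<-sucʳ : ∀ n (f : ℕ → ℕ) → ∑< (suc n) f ≡ ∑< n f + f n
  ∑<-sucʳ n f = begin
    sum (applyUpTo f (suc n))           ≡⟨ cong sum (sym (applyUpTo-∷ʳ f n)) ⟩
    sum (applyUpTo f n ++ f n ∷ [])     ≡⟨ sum-++ (applyUpTo f n) (f n ∷ []) ⟩
    ∑< n f + (f n + 0)                  ≡⟨ cong (∑< n f +_) (+-identityʳ (f n)) ⟩
    ∑< n f + f n                        ∎
    where open ≡-Reasoning

  ∑<-+ : ∀ n (f g : ℕ → ℕ) → ∑< n (λ i → f i + g i) ≡ ∑< n f + ∑< n g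
  ∑<-+ zero    f g = refl
  ∑<-+ (suc n) f g = trans (cong (f 0 + g 0 +_) (∑<-+ n (f ∘ suc) (g ∘ suc))) (interchange (f 0) (g 0) _ _)

  ∑<-truncate : ∀ (f : ℕ → ℕ) {h} n → h ≤ n → (∀ i → h ≤ i → f i ≡ 0) → ∑< n f ≡ ∑< h f
  ∑<-truncate f zero    z≤n       _   = refl
  ∑<-truncate f (suc n) z≤n       f≡0 =
    cong₂ _+_ (f≡0 0 z≤n) (∑<-truncate (f ∘ suc) n z≤n (λ i _ → f≡0 (suc i) z≤n))
  ∑<-truncate f (suc n) (s≤s h≤n) f≡0 =
    cong (f 0 +_) (∑<-truncate (f ∘ suc) n h≤n (λ i h≤i → f≡0 (suc i) (s≤s h≤i)))

shift-congAt : ∀ a s {f g : Series} → (a ≤ s → f (s ∸ a) ≡ g (s ∸ a)) → shift a f s ≡ shift a g s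
shift-congAt a s f≡g with a ≤? s
... | yes a≤s = f≡g a≤s
... | no  _   = refl

shift-cong : ∀ a {f g} → f ≗ g → shift a f ≗ shift a g
shift-cong a f≗g s = shift-congAt a s (λ _ → f≗g (s ∸ a))

shift-zero : ∀ f → shift 0 f ≗ f
shift-zero f s = shift-≤ f z≤n

shift-+ : ∀ a b f → shift (a + b) f ≗ shift a (shift b f)
shift-+ a b f s with a ≤? s
... | no a≰s = shift-≰ f (a≰s ∘ ≤-trans (m≤m+n a b))
... | yes a≤s with b ≤? s ∸ a
...   | yes b≤s∸a = trans (shift-≤ f (subst (a + b ≤_) (m+[n∸m]≡n a≤s) (+-monoʳ-≤ a b≤s∸a)))
                          (cong f (sym (∸-+-assoc s a b)))
...   | no  b≰s∸a = shift-≰ f (λ a+b≤s → b≰s∸a (subst (_≤ s ∸ a) (m+n∸m≡n a b) (∸-monoˡ-≤ a a+b≤s)))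

shift-⊕ : ∀ a f g → shift a (f ⊕ g) ≗ shift a f ⊕ shift a g
shift-⊕ a f g s with a ≤? s
... | yes _ = refl
... | no  _ = refl

∑<-shift : ∀ n a (F : ℕ → Series) s → ∑< n (λ b → shift a (F b) s) ≡ shift a (λ t → ∑< n (λ b → F b t)) s
∑<-shift n a F s with a ≤? s
... | yes _   = refl
... | no _ = trans (∑<-truncate _ n z≤n (λ _ _ → refl)) (∑<-zero _)

shift-⊛ : ∀ a f g → shift a f ⊛ g ≗ shift a (f ⊛ g)
shift-⊛ a f g = begin
  shift a f ⊛ g        ≈⟨ ⊛-congʳ g (≗.sym (qpow-⊛ a f)) ⟩
  (qpow a ⊛ f) ⊛ g     ≈⟨ ⊛-assoc (qpow a) f g ⟩
  qpow a ⊛ (f ⊛ g)     ≈⟨ qpow-⊛ a (f ⊛ g) ⟩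
  shift a (f ⊛ g)      ∎
  where open SetoidReasoning series-setoid

shift-qpow : ∀ a b → shift a (qpow b) ≗ qpow (a + b)
shift-qpow a b s with a ≤? s
... | no a≰s = sym (qpow-≢ (λ s≡a+b → a≰s (subst (a ≤_) (sym s≡a+b) (m≤m+n a b))))
... | yes a≤s = qpow-resp (λ s∸a≡b → trans (sym (m+[n∸m]≡n a≤s)) (cong (a +_) s∸a≡b))
                          (λ s≡a+b → trans (cong (_∸ a) s≡a+b) (m+n∸m≡n a b))

shift-fixpoint-unique : ∀ {j} → 1 ≤ j → ∀ {Z X Y} → X ≗ Z ⊕ shift j X → Y ≗ Z ⊕ shift j Y → X ≗ Y
shift-fixpoint-unique {j} 1≤j {Z} {X} {Y} X-fix Y-fix = <-rec (λ m → X m ≡ Y m) step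
  where
    step : ∀ m → (∀ {k} → k < m → X k ≡ Y k) → X m ≡ Y m
    step m ih = begin
      X m                    ≡⟨ X-fix m ⟩
      Z m + shift j X m      ≡⟨ cong (Z m +_) (shift-congAt j m (λ j≤m → ih (∸-monoʳ-< 1≤j j≤m))) ⟩
      Z m + shift j Y m      ≡⟨ Y-fix m ⟨
      Y m                    ∎
      where open ≡-Reasoning

inv1mq-≡1 : ∀ {d m} → d ∣ m → inv1mq d m ≡ 1
inv1mq-≡1 {d} {m} d∣m with d ∣? m
... | yes _    = refl
... | no  d∤m = contradiction d∣m d∤m

inv1mq-≡0 : ∀ {d m} → ¬ d ∣ m → inv1mq d m ≡ 0
inv1mq-≡0 {d} {m} d∤m with d ∣? m
... | yes d∣m = contradiction d∣m d∤m
... | no  _   = refl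

inv1mq-∸ : ∀ {d m} → d ≤ m → inv1mq d m ≡ inv1mq d (m ∸ d)
inv1mq-∸ {d} {m} d≤m with d ∣? m
... | yes d∣m = sym (inv1mq-≡1 (∣m+n∣m⇒∣n (subst (d ∣_) (sym (m+[n∸m]≡n d≤m)) d∣m) ∣-refl))
... | no  d∤m = sym (inv1mq-≡0 (λ d∣m∸d → d∤m (∣m∸n∣n⇒∣m d d≤m d∣m∸d ∣-refl)))

inv1mq-unfold : ∀ {d} → 1 ≤ d → inv1mq d ≗ oneS ⊕ shift d (inv1mq d)
inv1mq-unfold {d} 1≤d zero =
  trans (inv1mq-≡1 (d ∣0)) (sym (cong₂ _+_ (qpow-≡ 0) (shift-≰ (inv1mq d) (<⇒≱ 1≤d))))
inv1mq-unfold {d} 1≤d (suc m) with d ≤? suc m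
... | yes d≤m+1 = inv1mq-∸ d≤m+1
... | no  d≰m+1 = inv1mq-≡0 (d≰m+1 ∘ ∣⇒≤)

inv1mq-⊛-unfold : ∀ {d} → 1 ≤ d → ∀ f → inv1mq d ⊛ f ≗ f ⊕ shift d (inv1mq d ⊛ f)
inv1mq-⊛-unfold {d} 1≤d f = begin
  inv1mq d ⊛ f                                  ≈⟨ ⊛-congʳ f (inv1mq-unfold 1≤d) ⟩
  (oneS ⊕ shift d (inv1mq d)) ⊛ f               ≈⟨ ⊛-distribʳ-⊕ f oneS _ ⟩
  (oneS ⊛ f) ⊕ (shift d (inv1mq d) ⊛ f)         ≈⟨ ⊕-cong (⊛-identityˡ f) (shift-⊛ d (inv1mq d) f) ⟩
  f ⊕ shift d (inv1mq d ⊛ f)                    ∎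
  where open SetoidReasoning series-setoid

length-filter-tuples-suc : ∀ {P : Pred (List ℕ) 0ℓ} (P? : Decidable P) B r →
  length (filter P? (tuples B (suc r))) ≡ ∑< (suc B) (λ b → length (filter (P? ∘ (b ∷_)) (tuples B r)))
length-filter-tuples-suc P? B r = begin
  length (filter P? (tuples B (suc r)))
    ≡⟨ length-filter-concatMap P? (λ b → map (b ∷_) T) (upTo (suc B)) ⟩
  sum (map (λ b → length (filter P? (map (b ∷_) T))) (upTo (suc B)))
    ≡⟨ sum-map-upTo (suc B) _ ⟩
  ∑< (suc B) (λ b → length (filter P? (map (b ∷_) T)))
    ≡⟨ ∑<-cong (suc B) (λ b _ → trans (cong length (filter-map P? (b ∷_) T))
                                      (length-map (b ∷_) (filter (P? ∘ (b ∷_)) T))) ⟩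
  ∑< (suc B) (λ b → length (filter (P? ∘ (b ∷_)) T)) ∎
  where
    open ≡-Reasoning
    T = tuples B r

-- M_J(1, q, …, q^{h-1})
evalMFinite : List ℕ → ℕ → Series
evalMFinite []      h   = oneS
evalMFinite (j ∷ J) h s = ∑< h (λ b → shift (b * j) (evalMFinite J b) s)

DecreasingOfWeight : List ℕ → ℕ → Pred (List ℕ) 0ℓ
DecreasingOfWeight J s bs = StrictlyDecreasing bs × weight bs J ≡ s

decreasingOfWeight? : ∀ J s → Decidable (DecreasingOfWeight J s)
decreasingOfWeight? J s bs = strictlyDecreasing? bs ×-dec (weight bs J ≟ s)

-- the bound h is put in front of the tuple, so that StrictlyDecreasing also enforces h > b₁
BoundedOfWeight : ℕ → List ℕ → ℕ → Pred (List ℕ) 0ℓ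
BoundedOfWeight h J s bs = StrictlyDecreasing (h ∷ bs) × weight bs J ≡ s

boundedOfWeight? : ∀ h J s → Decidable (BoundedOfWeight h J s)
boundedOfWeight? h J s bs = strictlyDecreasing? (h ∷ bs) ×-dec (weight bs J ≟ s)

count : List ℕ → ℕ → ℕ → Series
count J B h s = length (filter (boundedOfWeight? h J s) (tuples B (length J)))

count-head : ∀ j J B b s →
  length (filter (decreasingOfWeight? (j ∷ J) s ∘ (b ∷_)) (tuples B (length J))) ≡ shift (b * j) (count J B b) s
count-head j J B b s with b * j ≤? s
... | yes bj≤s = cong length (filter-≐ _ _ (to , from) (tuples B (length J)))
  where
    to : ∀ {bs} → DecreasingOfWeight (j ∷ J) s (b ∷ bs) → BoundedOfWeight b J (s ∸ b * j) bs
    to (sd , w) = sd , trans (sym (m+n∸m≡n (b * j) _)) (cong (_∸ b * j) w)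
    from : ∀ {bs} → BoundedOfWeight b J (s ∸ b * j) bs → DecreasingOfWeight (j ∷ J) s (b ∷ bs)
    from (sd , w) = sd , trans (cong (b * j +_) w) (m+[n∸m]≡n bj≤s)
... | no bj≰s =
  cong length (filter-none (decreasingOfWeight? (j ∷ J) s ∘ (b ∷_))
    (All.universal (λ { _ (_ , w) → bj≰s (subst (b * j ≤_) w (m≤m+n _ _)) }) (tuples B (length J))))

count-cons : ∀ j J B {h} s → h ≤ suc B → count (j ∷ J) B h s ≡ ∑< h (λ b → shift (b * j) (count J B b) s)
count-cons j J B {h} s h≤B+1 = begin
  count (j ∷ J) B h s
    ≡⟨ length-filter-tuples-suc _ B (length J) ⟩
  ∑< (suc B) (λ b → length (filter (boundedOfWeight? h (j ∷ J) s ∘ (b ∷_)) T))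
    ≡⟨ ∑<-truncate _ (suc B) h≤B+1 (λ b h≤b → cong length (filter-none _ (All.universal (below-h h≤b) T))) ⟩
  ∑< h (λ b → length (filter (boundedOfWeight? h (j ∷ J) s ∘ (b ∷_)) T))
    ≡⟨ ∑<-cong h (λ b b<h → trans (cong length (filter-≐ _ _ (drop-h , add-h b<h) T)) (count-head j J B b s)) ⟩
  ∑< h (λ b → shift (b * j) (count J B b) s) ∎
  where
    open ≡-Reasoning
    T = tuples B (length J)
    below-h : ∀ {b} → h ≤ b → ∀ bs → ¬ BoundedOfWeight h (j ∷ J) s (b ∷ bs)
    below-h h≤b _ (sd∷ b<h _ , _) = <⇒≱ b<h h≤b
    drop-h : ∀ {b bs} → BoundedOfWeight h (j ∷ J) s (b ∷ bs) → DecreasingOfWeight (j ∷ J) s (b ∷ bs)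
    drop-h (sd∷ _ sd , w) = sd , w
    add-h : ∀ {b bs} → b < h → DecreasingOfWeight (j ∷ J) s (b ∷ bs) → BoundedOfWeight h (j ∷ J) s (b ∷ bs)
    add-h b<h (sd , w) = sd∷ b<h sd , w

count≡evalMFinite : ∀ J B {h} s → h ≤ suc B → count J B h s ≡ evalMFinite J h s
count≡evalMFinite []      B zero    _    = refl
count≡evalMFinite []      B (suc s) _    = refl
count≡evalMFinite (j ∷ J) B {h} s h≤B+1 = trans (count-cons j J B s h≤B+1) (∑<-cong h (λ b b<h →
  shift-cong (b * j) (λ t → count≡evalMFinite J B t (<⇒≤ (≤-trans b<h h≤B+1))) s))

evalM-as-evalMFinite : ∀ j J s → evalM (j ∷ J) s ≡ evalMFinite (j ∷ J) (suc s) s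
evalM-as-evalMFinite j J s = trans (length-filter-tuples-suc _ s (length J)) (∑<-cong (suc s) (λ b b≤s →
  trans (count-head j J s b s) (shift-cong (b * j) (λ t → count≡evalMFinite J s t (<⇒≤ b≤s)) s)))

evalMFinite-suc₁ : ∀ j h → evalMFinite (j ∷ []) (suc h) ≗ oneS ⊕ shift j (evalMFinite (j ∷ []) h)
evalMFinite-suc₁ j h s = trans (∑<-sucˡ h _) (cong₂ _+_ (shift-zero oneS s) (begin
  ∑< h (λ b → shift (j + b * j) oneS s)              ≡⟨ ∑<-cong h (λ b _ → shift-+ j (b * j) oneS s) ⟩
  ∑< h (λ b → shift j (shift (b * j) oneS) s)        ≡⟨ ∑<-shift h j (λ b → shift (b * j) oneS) s ⟩
  shift j (evalMFinite (j ∷ []) h) s                 ∎))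
  where open ≡-Reasoning

-- The b₁ = 0 term vanishes; for b₁ = b + 1 the terms b₂ < b and b₂ = b give the two summands,
-- the latter merging the first two parts.
evalMFinite-suc₂ : ∀ j₁ j₂ J h →
  evalMFinite (j₁ ∷ j₂ ∷ J) (suc h) ≗ shift j₁ (evalMFinite (j₁ ∷ j₂ ∷ J) h ⊕ evalMFinite (j₁ + j₂ ∷ J) h)
evalMFinite-suc₂ j₁ j₂ J h s = begin
  evalMFinite (j₁ ∷ j₂ ∷ J) (suc h) s
    ≡⟨ ∑<-sucˡ h _ ⟩
  shift 0 (evalMFinite (j₂ ∷ J) 0) s + ∑< h (λ b → shift (suc b * j₁) (evalMFinite (j₂ ∷ J) (suc b)) s)
    ≡⟨ cong₂ _+_ (trans (shift-zero (evalMFinite (j₂ ∷ J) 0) s) (∑<-zero _)) (∑<-cong h (λ b _ → peel b)) ⟩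
  ∑< h (λ b → shift j₁ (F b ⊕ G b) s)
    ≡⟨ ∑<-shift h j₁ (λ b → F b ⊕ G b) s ⟩
  shift j₁ (λ t → ∑< h (λ b → F b t + G b t)) s
    ≡⟨ shift-cong j₁ (λ t → ∑<-+ h (λ b → F b t) (λ b → G b t)) s ⟩
  shift j₁ (evalMFinite (j₁ ∷ j₂ ∷ J) h ⊕ evalMFinite (j₁ + j₂ ∷ J) h) s ∎
  where
    open ≡-Reasoning
    F G : ℕ → Series
    F b = shift (b * j₁) (evalMFinite (j₂ ∷ J) b)
    G b = shift (b * (j₁ + j₂)) (evalMFinite J b)
    split : ∀ b → shift (b * j₁) (evalMFinite (j₂ ∷ J) (suc b)) ≗ F b ⊕ G b
    split b = ≗.trans (shift-cong (b * j₁) (λ t → ∑<-sucʳ b _))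
      (≗.trans (shift-⊕ (b * j₁) _ _) (⊕-cong {F b} ≗.refl (≗.trans (≗.sym (shift-+ (b * j₁) (b * j₂) _))
        (≗.reflexive (cong (λ e → shift e (evalMFinite J b)) (sym (*-distribˡ-+ b j₁ j₂)))))))
    peel : ∀ b → shift (suc b * j₁) (evalMFinite (j₂ ∷ J) (suc b)) s ≡ shift j₁ (F b ⊕ G b) s
    peel b = trans (shift-+ j₁ (b * j₁) _ s) (shift-cong j₁ (split b) s)

evalMFinite-stable : ∀ {j} J → 1 ≤ j → ∀ {h s} → s < h → evalMFinite (j ∷ J) h s ≡ evalMFinite (j ∷ J) (suc s) s
evalMFinite-stable {j} J 1≤j {h} {s} s<h = ∑<-truncate _ h s<h (λ b s<b →
  shift-≰ (evalMFinite J b) (<⇒≱ (≤-trans s<b (m≤m*n b j {{>-nonZero 1≤j}}))))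

evalM≡evalMFinite : ∀ {j} J → 1 ≤ j → ∀ {h s} → s < h → evalM (j ∷ J) s ≡ evalMFinite (j ∷ J) h s
evalM≡evalMFinite {j} J 1≤j s<h = trans (evalM-as-evalMFinite j J _) (sym (evalMFinite-stable J 1≤j s<h))

evalM-unfold₁ : ∀ {j} → 1 ≤ j → evalM (j ∷ []) ≗ oneS ⊕ shift j (evalM (j ∷ []))
evalM-unfold₁ {j} 1≤j s = begin
  evalM (j ∷ []) s                              ≡⟨ evalM-as-evalMFinite j [] s ⟩
  evalMFinite (j ∷ []) (suc s) s                ≡⟨ evalMFinite-suc₁ j s s ⟩
  oneS s + shift j (evalMFinite (j ∷ []) s) s   ≡⟨ cong (oneS s +_) (shift-congAt j s (λ j≤s →
                                                     evalM≡evalMFinite [] 1≤j (∸-monoʳ-< 1≤j j≤s))) ⟨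
  oneS s + shift j (evalM (j ∷ [])) s           ∎
  where open ≡-Reasoning

evalM-unfold₂ : ∀ {j₁} j₂ J → 1 ≤ j₁ → evalM (j₁ ∷ j₂ ∷ J) ≗ shift j₁ (evalM (j₁ ∷ j₂ ∷ J) ⊕ evalM (j₁ + j₂ ∷ J))
evalM-unfold₂ {j₁} j₂ J 1≤j₁ s = begin
  evalM (j₁ ∷ j₂ ∷ J) s
    ≡⟨ evalM-as-evalMFinite j₁ (j₂ ∷ J) s ⟩
  evalMFinite (j₁ ∷ j₂ ∷ J) (suc s) s
    ≡⟨ evalMFinite-suc₂ j₁ j₂ J s s ⟩
  shift j₁ (evalMFinite (j₁ ∷ j₂ ∷ J) s ⊕ evalMFinite (j₁ + j₂ ∷ J) s) s
    ≡⟨ shift-congAt j₁ s (λ j₁≤s → let s∸j₁<s = ∸-monoʳ-< 1≤j₁ j₁≤s in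
         cong₂ _+_ (evalM≡evalMFinite (j₂ ∷ J) 1≤j₁ s∸j₁<s)
                   (evalM≡evalMFinite J (≤-trans 1≤j₁ (m≤m+n j₁ j₂)) s∸j₁<s)) ⟨
  shift j₁ (evalM (j₁ ∷ j₂ ∷ J) ⊕ evalM (j₁ + j₂ ∷ J)) s ∎
  where open ≡-Reasoning

qOver1mq : ℕ → Series
qOver1mq d = qpow d ⊛ inv1mq d

prodOver : (ℕ → Series) → List ℕ → Series
prodOver F = foldr (λ d s → F d ⊛ s) oneS

prodOver-map : ∀ F (g : ℕ → ℕ) D → prodOver F (map g D) ≡ prodOver (F ∘ g) D
prodOver-map F g D = foldr-map (λ d s → F d ⊛ s) g oneS D

prodOver-qpow : ∀ D → prodOver qpow D ≗ qpow (sum D)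
prodOver-qpow []      = ≗.refl
prodOver-qpow (d ∷ D) = ≗.trans (⊛-congˡ (qpow d) (prodOver-qpow D))
                                (≗.trans (qpow-⊛ d (qpow (sum D))) (shift-qpow d (sum D)))

des-cons : ∀ j₁ j₂ J → des (j₁ ∷ j₂ ∷ J) ≡ j₁ ∷ des (j₁ + j₂ ∷ J)
des-cons j₁ j₂ []      = refl
des-cons j₁ j₂ (_ ∷ _) = refl

evalM-closedForm : ∀ {j} J → 1 ≤ j → evalM (j ∷ J) ≗ inv1mq (j + sum J) ⊛ prodOver qOver1mq (des (j ∷ J))
evalM-closedForm {j} [] 1≤j = begin
  evalM (j ∷ [])          ≈⟨ shift-fixpoint-unique 1≤j (evalM-unfold₁ 1≤j) (inv1mq-unfold 1≤j) ⟩
  inv1mq j                ≈⟨ ⊛-identityʳ (inv1mq j) ⟨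
  inv1mq j ⊛ oneS         ≡⟨ cong (λ n → inv1mq n ⊛ oneS) (+-identityʳ j) ⟨
  inv1mq (j + 0) ⊛ oneS   ∎
  where open SetoidReasoning series-setoid
evalM-closedForm {j} (j₂ ∷ J) 1≤j = begin
  X                                             ≈⟨ shift-fixpoint-unique 1≤j X-fix T-fix ⟩
  shift j (inv1mq j ⊛ Y)                        ≈⟨ qpow-⊛ j (inv1mq j ⊛ Y) ⟨
  qpow j ⊛ (inv1mq j ⊛ Y)                       ≈⟨ ⊛-assoc (qpow j) (inv1mq j) Y ⟨
  qOver1mq j ⊛ Y                                ≈⟨ ⊛-congˡ (qOver1mq j) (evalM-closedForm J (≤-trans 1≤j (m≤m+n j j₂))) ⟩
  qOver1mq j ⊛ (inv1mq (j + j₂ + sum J) ⊛ P)    ≈⟨ x⊛yz≗y⊛xz (qOver1mq j) (inv1mq (j + j₂ + sum J)) P ⟩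
  inv1mq (j + j₂ + sum J) ⊛ (qOver1mq j ⊛ P)    ≡⟨ cong₂ (λ n D → inv1mq n ⊛ prodOver qOver1mq D)
                                                         (+-assoc j j₂ (sum J)) (sym (des-cons j j₂ J)) ⟩
  inv1mq (j + sum (j₂ ∷ J)) ⊛ prodOver qOver1mq (des (j ∷ j₂ ∷ J)) ∎
  where
    open SetoidReasoning series-setoid
    X = evalM (j ∷ j₂ ∷ J)
    Y = evalM (j + j₂ ∷ J)
    P = prodOver qOver1mq (des (j + j₂ ∷ J))
    X-fix : X ≗ shift j Y ⊕ shift j X
    X-fix = ≗.trans (evalM-unfold₂ j₂ J 1≤j) (≗.trans (shift-⊕ j X Y) (⊕-comm (shift j X) (shift j Y)))
    T-fix : shift j (inv1mq j ⊛ Y) ≗ shift j Y ⊕ shift j (shift j (inv1mq j ⊛ Y))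
    T-fix = ≗.trans (shift-cong j (inv1mq-⊛-unfold 1≤j Y)) (shift-⊕ j Y _)

bitVectors : (k : ℕ) → List (Vec Bool k)
bitVectors zero    = [] ∷ []
bitVectors (suc k) = concatMap (λ v → map (_∷ v) (true ∷ false ∷ [])) (bitVectors k)

-- 1-based positions of the entries true
support : ∀ {k} → Vec Bool k → List ℕ
support []          = []
support (true ∷ v)  = 1 ∷ map suc (support v)
support (false ∷ v) = map suc (support v)

-- entry i of v records whether i + 1 is a descent of toComposition v
firstPart : ∀ {k} → Vec Bool k → ℕ
otherParts : ∀ {k} → Vec Bool k → List ℕ

toComposition : ∀ {k} → Vec Bool k → List ℕ
toComposition v = firstPart v ∷ otherParts v

firstPart []          = 1
firstPart (true ∷ v)  = 1
firstPart (false ∷ v) = suc (firstPart v)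

otherParts []          = []
otherParts (true ∷ v)  = toComposition v
otherParts (false ∷ v) = otherParts v

comps≡map-toComposition : ∀ k → comps (suc k) ≡ map toComposition (bitVectors k)
comps≡map-toComposition zero    = refl
comps≡map-toComposition (suc k) = begin
  concatMap (λ J → (1 ∷ J) ∷ bumpHead J ∷ []) (comps (suc k))
    ≡⟨ cong (concatMap _) (comps≡map-toComposition k) ⟩
  concatMap (λ J → (1 ∷ J) ∷ bumpHead J ∷ []) (map toComposition (bitVectors k))
    ≡⟨ concatMap-map _ toComposition (bitVectors k) ⟩
  concatMap (λ v → map toComposition (map (_∷ v) (true ∷ false ∷ []))) (bitVectors k)
    ≡⟨ map-concatMap toComposition _ (bitVectors k) ⟨
  map toComposition (bitVectors (suc k)) ∎
  where open ≡-Reasoning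

toComposition-isComposition : ∀ {k} (v : Vec Bool k) → IsComposition (suc k) (toComposition v)
toComposition-isComposition []          = s≤s z≤n ∷ [] , refl
toComposition-isComposition (true ∷ v)  with toComposition-isComposition v
... | pos , sum≡ = s≤s z≤n ∷ pos , cong suc sum≡
toComposition-isComposition (false ∷ v) with toComposition-isComposition v
... | p ∷ pos , sum≡ = m≤n⇒m≤1+n p ∷ pos , cong suc sum≡

toComposition-surjective : ∀ k J → IsComposition (suc k) J → Σ (Vec Bool k) λ v → toComposition v ≡ J
toComposition-surjective k       []                (_ , ())
toComposition-surjective zero    (1 ∷ [])          _ = [] , refl
toComposition-surjective zero    (1 ∷ j ∷ J)       (_ ∷ s≤s _ ∷ _ , ())
toComposition-surjective (suc k) (1 ∷ [])          (_ , ())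
toComposition-surjective (suc k) (1 ∷ j ∷ J)       (_ ∷ pos , sum≡)
  with toComposition-surjective k (j ∷ J) (pos , suc-injective sum≡)
... | v , v↦J = true ∷ v , cong (1 ∷_) v↦J
toComposition-surjective zero    (suc (suc i) ∷ J) (_ , ())
toComposition-surjective (suc k) (suc (suc i) ∷ J) (_ ∷ pos , sum≡)
  with toComposition-surjective k (suc i ∷ J) (s≤s z≤n ∷ pos , suc-injective sum≡)
... | v , v↦J = false ∷ v , cong bumpHead v↦J

desFrom-suc : ∀ a xs → desFrom (suc a) xs ≡ map suc (desFrom a xs)
desFrom-suc a []           = refl
desFrom-suc a (x ∷ [])     = refl
desFrom-suc a (x ∷ y ∷ ys) = cong (suc (a + x) ∷_) (desFrom-suc (a + x) (y ∷ ys))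

des-bumpHead : ∀ J → des (bumpHead J) ≡ map suc (des J)
des-bumpHead []           = refl
des-bumpHead (x ∷ [])     = refl
des-bumpHead (x ∷ y ∷ ys) = cong (suc x ∷_) (desFrom-suc x (y ∷ ys))

des-toComposition : ∀ {k} (v : Vec Bool k) → des (toComposition v) ≡ support v
des-toComposition []          = refl
des-toComposition (true ∷ v)  =
  cong (1 ∷_) (trans (desFrom-suc 0 (toComposition v)) (cong (map suc) (des-toComposition v)))
des-toComposition (false ∷ v) = trans (des-bumpHead (toComposition v)) (cong (map suc) (des-toComposition v))

_≤ᵛ_ : ∀ {k} → Vec Bool k → Vec Bool k → Set
_≤ᵛ_ = Pointwise Bool._≤_

∈support⇒pos : ∀ {k} (v : Vec Bool k) {z} → z ∈ support v → 0 < z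
∈support⇒pos (true ∷ v)  (here refl) = z<s
∈support⇒pos (true ∷ v)  (there z∈) with ∈-map⁻ suc z∈
... | _ , _ , refl = z<s
∈support⇒pos (false ∷ v) z∈          with ∈-map⁻ suc z∈
... | _ , _ , refl = z<s

∈support-∷⁺ : ∀ {k} x (v : Vec Bool k) {z} → z ∈ support v → suc z ∈ support (x ∷ v)
∈support-∷⁺ true  v z∈ = there (∈-map⁺ suc z∈)
∈support-∷⁺ false v z∈ = ∈-map⁺ suc z∈

∈support-∷⁻ : ∀ {k} x (v : Vec Bool k) {z} → 0 < z → suc z ∈ support (x ∷ v) → z ∈ support v
∈support-∷⁻ true  v z<s (here ())
∈support-∷⁻ true  v _   (there sz∈) = suc∈map-suc⁻ sz∈
  where
    suc∈map-suc⁻ : ∀ {z xs} → suc z ∈ map suc xs → z ∈ xs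
    suc∈map-suc⁻ sz∈ with ∈-map⁻ suc sz∈
    ... | _ , z∈ , refl = z∈
∈support-∷⁻ false v _   sz∈ with ∈-map⁻ suc sz∈
... | _ , z∈ , refl = z∈

≤ᵛ⇒support-⊆ : ∀ {k} {v w : Vec Bool k} → v ≤ᵛ w → support v ⊆ support w
≤ᵛ⇒support-⊆ []                   = λ ()
≤ᵛ⇒support-⊆ (b≤b {true}  ∷ v≤w) = ∷⁺ʳ 1 (map⁺ suc (≤ᵛ⇒support-⊆ v≤w))
≤ᵛ⇒support-⊆ (b≤b {false} ∷ v≤w) = map⁺ suc (≤ᵛ⇒support-⊆ v≤w)
≤ᵛ⇒support-⊆ (f≤t ∷ v≤w)         = ⊆-trans (map⁺ suc (≤ᵛ⇒support-⊆ v≤w)) (xs⊆x∷xs _ 1)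

support-⊆⇒≤ᵛ : ∀ {k} (v w : Vec Bool k) → support v ⊆ support w → v ≤ᵛ w
support-⊆⇒≤ᵛ []      []      _  = []
support-⊆⇒≤ᵛ (x ∷ v) (y ∷ w) ⊆w = head x y ⊆w ∷ support-⊆⇒≤ᵛ v w tail
  where
    head : ∀ x y → support (x ∷ v) ⊆ support (y ∷ w) → x Bool.≤ y
    head false false _  = b≤b
    head false true  _  = f≤t
    head true  true  _  = b≤b
    head true  false ⊆w with ∈-map⁻ suc (⊆w (here refl))
    ... | _ , 0∈ , refl = contradiction (∈support⇒pos w 0∈) (<-irrefl refl)
    tail : support v ⊆ support w
    tail z∈ = ∈support-∷⁻ y w (∈support⇒pos v z∈) (⊆w (∈support-∷⁺ x v z∈))

Between : ∀ {k} → Vec Bool k → Vec Bool k → Pred (Vec Bool k) 0ℓ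
Between vI vK v = vI ≤ᵛ v × v ≤ᵛ vK

between? : ∀ {k} (vI vK : Vec Bool k) → Decidable (Between vI vK)
between? vI vK v = Pointwise.decidable _≤ᵇ?_ vI v ×-dec Pointwise.decidable _≤ᵇ?_ v vK

bitBetween? : ∀ b c → Decidable (λ x → b Bool.≤ x × x Bool.≤ c)
bitBetween? b c x = b ≤ᵇ? x ×-dec x ≤ᵇ? c

bitsBetween : Bool → Bool → List Bool
bitsBetween b c = filter (bitBetween? b c) (true ∷ false ∷ [])

filter-between-∷⁺ : ∀ {k} b c {vI vK v : Vec Bool k} → Between vI vK v → ∀ xs →
  filter (between? (b ∷ vI) (c ∷ vK)) (map (_∷ v) xs) ≡ map (_∷ v) (filter (bitBetween? b c) xs)
filter-between-∷⁺ b c {vI} {vK} {v} (vI≤v , v≤vK) xs =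
  trans (filter-map (between? (b ∷ vI) (c ∷ vK)) (_∷ v) xs) (cong (map (_∷ v)) (filter-≐ _ _ (to , from) xs))
  where
    to : ∀ {x} → Between (b ∷ vI) (c ∷ vK) (x ∷ v) → b Bool.≤ x × x Bool.≤ c
    to (b≤x ∷ _ , x≤c ∷ _) = b≤x , x≤c
    from : ∀ {x} → b Bool.≤ x × x Bool.≤ c → Between (b ∷ vI) (c ∷ vK) (x ∷ v)
    from (b≤x , x≤c) = b≤x ∷ vI≤v , x≤c ∷ v≤vK

filter-between-∷⁻ : ∀ {k} b c {vI vK v : Vec Bool k} → ¬ Between vI vK v → ∀ xs →
  filter (between? (b ∷ vI) (c ∷ vK)) (map (_∷ v) xs) ≡ []
filter-between-∷⁻ b c {vI} {vK} {v} v∉ xs =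
  trans (filter-map (between? (b ∷ vI) (c ∷ vK)) (_∷ v) xs)
        (cong (map (_∷ v)) (filter-none _ (All.universal (λ { _ (_ ∷ vI≤v , _ ∷ v≤vK) → v∉ (vI≤v , v≤vK) }) xs)))

module _ {k} (b c : Bool) (vI vK : Vec Bool k) where
  private
    extendAll extendBetween : Vec Bool k → List (Vec Bool (suc k))
    extendAll     v = map (_∷ v) (true ∷ false ∷ [])
    extendBetween v = map (_∷ v) (bitsBetween b c)
    P = between? (b ∷ vI) (c ∷ vK)

  filter-between-extend : ∀ vs →
    filter (between? (b ∷ vI) (c ∷ vK)) (concatMap extendAll vs) ≡ concatMap extendBetween (filter (between? vI vK) vs)
  filter-between-extend []       = refl
  filter-between-extend (v ∷ vs) with between? vI vK v
  ... | yes v∈ = begin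
    filter P (extendAll v ++ concatMap extendAll vs)
      ≡⟨ filter-++ P (extendAll v) (concatMap extendAll vs) ⟩
    filter P (extendAll v) ++ filter P (concatMap extendAll vs)
      ≡⟨ cong₂ _++_ (filter-between-∷⁺ b c v∈ _) (filter-between-extend vs) ⟩
    extendBetween v ++ concatMap extendBetween (filter (between? vI vK) vs)
      ≡⟨ cong (concatMap extendBetween) (filter-accept (between? vI vK) v∈) ⟨
    concatMap extendBetween (filter (between? vI vK) (v ∷ vs)) ∎
    where open ≡-Reasoning
  ... | no  v∉ = begin
    filter P (extendAll v ++ concatMap extendAll vs)
      ≡⟨ filter-++ P (extendAll v) (concatMap extendAll vs) ⟩
    filter P (extendAll v) ++ filter P (concatMap extendAll vs)
      ≡⟨ cong₂ _++_ (filter-between-∷⁻ b c v∉ _) (filter-between-extend vs) ⟩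
    concatMap extendBetween (filter (between? vI vK) vs)
      ≡⟨ cong (concatMap extendBetween) (filter-reject (between? vI vK) v∉) ⟨
    concatMap extendBetween (filter (between? vI vK) (v ∷ vs)) ∎
    where open ≡-Reasoning

bitFactor : (ℕ → Series) → Bool → Series
bitFactor F true  = F 1
bitFactor F false = oneS

prodOver-support-∷ : ∀ {k} F x (v : Vec Bool k) →
  prodOver F (support (x ∷ v)) ≗ bitFactor F x ⊛ prodOver (F ∘ suc) (support v)
prodOver-support-∷ F true  v = ⊛-congˡ (F 1) (≗.reflexive (prodOver-map F suc (support v)))
prodOver-support-∷ F false v = ≗.trans (≗.reflexive (prodOver-map F suc (support v))) (≗.sym (⊛-identityˡ _))

sumS-bitFactor-between : ∀ {A B C : ℕ → Series} → B 1 ≗ oneS ⊕ A 1 → A 1 ≗ C 1 ⊛ B 1 →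
  ∀ {b c} → b Bool.≤ c → sumS (map (bitFactor A) (bitsBetween b c)) ≗ bitFactor C b ⊛ bitFactor B c
sumS-bitFactor-between {A} {B} B≗1+A _ f≤t m = begin
  A 1 m + (oneS m + 0)  ≡⟨ cong (A 1 m +_) (+-identityʳ (oneS m)) ⟩
  A 1 m + oneS m        ≡⟨ +-comm (A 1 m) (oneS m) ⟩
  oneS m + A 1 m        ≡⟨ B≗1+A m ⟨
  B 1 m                 ≡⟨ ⊛-identityˡ (B 1) m ⟨
  (oneS ⊛ B 1) m        ∎
  where open ≡-Reasoning
sumS-bitFactor-between {A} _ A≗CB (b≤b {true})  m = trans (+-identityʳ (A 1 m)) (A≗CB m)
sumS-bitFactor-between     _ _    (b≤b {false}) m = trans (+-identityʳ (oneS m)) (sym (⊛-identityˡ oneS m))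

sumS-between : ∀ {k} (A B C : ℕ → Series) →
  (∀ d → B (suc d) ≗ oneS ⊕ A (suc d)) → (∀ d → A (suc d) ≗ C (suc d) ⊛ B (suc d)) →
  ∀ {vI vK : Vec Bool k} → vI ≤ᵛ vK →
  sumS (map (prodOver A ∘ support) (filter (between? vI vK) (bitVectors k)))
  ≗ prodOver C (support vI) ⊛ prodOver B (support vK)
sumS-between A B C B≗1+A A≗CB [] m = trans (+-identityʳ (oneS m)) (sym (⊛-identityˡ oneS m))
sumS-between {suc k} A B C B≗1+A A≗CB {b ∷ vI} {c ∷ vK} (b≤c ∷ vI≤vK) = begin
  sumS (map G (filter (between? (b ∷ vI) (c ∷ vK)) (bitVectors (suc k))))
    ≡⟨ cong (sumS ∘ map G) (filter-between-extend b c vI vK (bitVectors k)) ⟩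
  sumS (map G (concatMap (λ v → map (_∷ v) (bitsBetween b c)) Vs))
    ≈⟨ sumS-concatMap G _ Vs ⟩
  sumS (map (λ v → sumS (map G (map (_∷ v) (bitsBetween b c)))) Vs)
    ≈⟨ sumS-cong extension Vs ⟩
  sumS (map (λ v → W ⊛ G′ v) Vs)
    ≈⟨ ⊛-distribˡ-sumS W G′ Vs ⟩
  W ⊛ sumS (map G′ Vs)
    ≈⟨ ⊛-congˡ W (sumS-between (A ∘ suc) (B ∘ suc) (C ∘ suc) (B≗1+A ∘ suc) (A≗CB ∘ suc) vI≤vK) ⟩
  W ⊛ (PC′ ⊛ PB′)
    ≈⟨ ⊛-congʳ (PC′ ⊛ PB′) (sumS-bitFactor-between (B≗1+A 0) (A≗CB 0) b≤c) ⟩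
  (bitFactor C b ⊛ bitFactor B c) ⊛ (PC′ ⊛ PB′)
    ≈⟨ ⊛-interchange (bitFactor C b) (bitFactor B c) PC′ PB′ ⟩
  (bitFactor C b ⊛ PC′) ⊛ (bitFactor B c ⊛ PB′)
    ≈⟨ ⊛-cong (prodOver-support-∷ C b vI) (prodOver-support-∷ B c vK) ⟨
  prodOver C (support (b ∷ vI)) ⊛ prodOver B (support (c ∷ vK)) ∎
  where
    open SetoidReasoning series-setoid
    G = prodOver A ∘ support
    G′ = prodOver (A ∘ suc) ∘ support
    Vs = filter (between? vI vK) (bitVectors k)
    W = sumS (map (bitFactor A) (bitsBetween b c))
    PC′ = prodOver (C ∘ suc) (support vI)
    PB′ = prodOver (B ∘ suc) (support vK)
    extension : ∀ v → sumS (map G (map (_∷ v) (bitsBetween b c))) ≗ W ⊛ G′ v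
    extension v = begin
      sumS (map G (map (_∷ v) xs))              ≡⟨ cong sumS (map-∘ xs) ⟨
      sumS (map (λ x → G (x ∷ v)) xs)           ≈⟨ sumS-cong (λ x → prodOver-support-∷ A x v) xs ⟩
      sumS (map (λ x → bitFactor A x ⊛ G′ v) xs) ≈⟨ ⊛-distribʳ-sumS (G′ v) (bitFactor A) xs ⟩
      W ⊛ G′ v                                  ∎
      where xs = bitsBetween b c

inv1mq≗1+qOver1mq : ∀ {d} → 1 ≤ d → inv1mq d ≗ oneS ⊕ qOver1mq d
inv1mq≗1+qOver1mq {d} 1≤d = ≗.trans (inv1mq-unfold 1≤d) (⊕-cong {oneS} ≗.refl (≗.sym (qpow-⊛ d (inv1mq d))))

evalM-composition : ∀ {n} J → IsComposition (suc n) J → evalM J ≗ inv1mq (suc n) ⊛ prodOver qOver1mq (des J)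
evalM-composition (j ∷ J) (1≤j ∷ _ , sum≡) =
  ≗.trans (evalM-closedForm J 1≤j) (λ m → cong (λ n → (inv1mq n ⊛ prodOver qOver1mq (des (j ∷ J))) m) sum≡)

toComposition-⊆⇒≤ᵛ : ∀ {k} (v w : Vec Bool k) → des (toComposition v) ⊆ des (toComposition w) → v ≤ᵛ w
toComposition-⊆⇒≤ᵛ v w rewrite des-toComposition v | des-toComposition w = support-⊆⇒≤ᵛ v w

toComposition-≤ᵛ⇒⊆ : ∀ {k} {v w : Vec Bool k} → v ≤ᵛ w → des (toComposition v) ⊆ des (toComposition w)
toComposition-≤ᵛ⇒⊆ {v = v} {w} v≤w rewrite des-toComposition v | des-toComposition w = ≤ᵛ⇒support-⊆ v≤w

interval-toComposition : ∀ {k} (vI vK : Vec Bool k) →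
  interval (suc k) (toComposition vI) (toComposition vK) ≡ map toComposition (filter (between? vI vK) (bitVectors k))
interval-toComposition {k} vI vK = begin
  filter (inInterval? I K) (comps (suc k))
    ≡⟨ cong (filter (inInterval? I K)) (comps≡map-toComposition k) ⟩
  filter (inInterval? I K) (map toComposition (bitVectors k))
    ≡⟨ filter-map (inInterval? I K) toComposition (bitVectors k) ⟩
  map toComposition (filter (inInterval? I K ∘ toComposition) (bitVectors k))
    ≡⟨ cong (map toComposition) (filter-≐ _ (between? vI vK) (to , from) (bitVectors k)) ⟩
  map toComposition (filter (between? vI vK) (bitVectors k)) ∎
  where
    open ≡-Reasoning
    I = toComposition vI
    K = toComposition vK
    to : ∀ {v} → All (_∈ des (toComposition v)) (des I) × All (_∈ des K) (des (toComposition v)) → Between vI vK v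
    to {v} (I⊆v , v⊆K) = toComposition-⊆⇒≤ᵛ vI v (All.lookup I⊆v) , toComposition-⊆⇒≤ᵛ v vK (All.lookup v⊆K)
    from : ∀ {v} → Between vI vK v → All (_∈ des (toComposition v)) (des I) × All (_∈ des K) (des (toComposition v))
    from (vI≤v , v≤vK) = All.tabulate (toComposition-≤ᵛ⇒⊆ vI≤v) , All.tabulate (toComposition-≤ᵛ⇒⊆ v≤vK)

sumS-evalM-interval : ∀ {k} (vI vK : Vec Bool k) → vI ≤ᵛ vK →
  sumS (map evalM (interval (suc k) (toComposition vI) (toComposition vK)))
  ≗ qpow (maj (toComposition vI)) ⊛ inv1mq (suc k) ⊛ prodInv (des (toComposition vK))
sumS-evalM-interval {k} vI vK vI≤vK = begin
  sumS (map evalM (interval (suc k) I K))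
    ≡⟨ cong (sumS ∘ map evalM) (interval-toComposition vI vK) ⟩
  sumS (map evalM (map toComposition Vs))
    ≡⟨ cong sumS (map-∘ Vs) ⟨
  sumS (map (evalM ∘ toComposition) Vs)
    ≈⟨ sumS-cong evalM-toComposition Vs ⟩
  sumS (map (λ v → N ⊛ prodOver qOver1mq (support v)) Vs)
    ≈⟨ ⊛-distribˡ-sumS N (prodOver qOver1mq ∘ support) Vs ⟩
  N ⊛ sumS (map (prodOver qOver1mq ∘ support) Vs)
    ≈⟨ ⊛-congˡ N (sumS-between qOver1mq inv1mq qpow (λ _ → inv1mq≗1+qOver1mq (s≤s z≤n)) (λ _ → ≗.refl) vI≤vK) ⟩
  N ⊛ (prodOver qpow (support vI) ⊛ prodInv (support vK))
    ≈⟨ ⊛-congˡ N (⊛-congʳ (prodInv (support vK)) (prodOver-qpow (support vI))) ⟩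
  N ⊛ (qpow (sum (support vI)) ⊛ prodInv (support vK))
    ≡⟨ cong₂ (λ D E → N ⊛ (qpow (sum D) ⊛ prodInv E)) (des-toComposition vI) (des-toComposition vK) ⟨
  N ⊛ (qpow (maj I) ⊛ prodInv (des K))
    ≈⟨ x⊛yz≗y⊛xz N (qpow (maj I)) (prodInv (des K)) ⟩
  qpow (maj I) ⊛ (N ⊛ prodInv (des K))
    ≈⟨ ⊛-assoc (qpow (maj I)) N (prodInv (des K)) ⟨
  qpow (maj I) ⊛ N ⊛ prodInv (des K) ∎
  where
    open SetoidReasoning series-setoid
    I = toComposition vI
    K = toComposition vK
    N = inv1mq (suc k)
    Vs = filter (between? vI vK) (bitVectors k)
    evalM-toComposition : ∀ v → evalM (toComposition v) ≗ N ⊛ prodOver qOver1mq (support v)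
    evalM-toComposition v = ≗.trans (evalM-composition (toComposition v) (toComposition-isComposition v))
                                    (≗.reflexive (cong (λ D → N ⊛ prodOver qOver1mq D) (des-toComposition v)))

lemma6p14 : (n : ℕ) → 1 ≤ n → (I K : List ℕ) →
    IsComposition n I → IsComposition n K → des I ⊆ des K →
    ∀ m → sumS (map evalM (interval n I K)) m
          ≡ (qpow (maj I) ⊛ inv1mq n ⊛ prodInv (des K)) m
lemma6p14 (suc k) _ I K I-comp K-comp desI⊆desK
  with toComposition-surjective k I I-comp | toComposition-surjective k K K-comp
... | vI , refl | vK , refl = sumS-evalM-interval vI vK (toComposition-⊆⇒≤ᵛ vI vK desI⊆desK)
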